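{- Let $d \in \{ -1,-2,-3,-7,-11\}$ and let $\mathbb{D}[d] = \mathbb{Z}[\omega]$ be the ring of integers of $\mathbb{Q}(\sqrt{d})$. Let $x, n \in \mathbb{D}[d]$ with $n = s + t\omega$ ($s,t \in \mathbb{Z}$) such that $|n|^2$ is odd, $|n| \neq 1$, and $\gcd(t, |n|^2) = 1$. Then there exist $q \in \mathbb{D}[d]$ and $r \in \mathbb{Z}$ with $|r| \le (|n|^2 - 1)/2$ and $x = nq + r$.
   Context: $\omega = \sqrt{d}$ for $d \in \{ -1,-2\}$ and $\omega = \tfrac{1+\sqrt{d}}{2}$ for $d \in \{ -3,-7,-11\}$; every element of $\mathbb{D}[d]$ is uniquely $s + t\omega$ with $s,t\in\mathbb{Z}$, and $t$ is called its nonreal component. $|n|$ is the complex absolute value, so $|n|^2$ is the norm of $n$, an integer. -}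

module Defs where

open import Data.Integer using (ℤ; +_; -_; _+_; _*_; _-_; ∣_∣; -[1+_])
open import Data.Nat as ℕ using (ℕ)

data D : Set where
  d-1 d-2 d-3 d-7 d-11 : D

dval : D → ℤ
dval d-1  = - (+ 1)
dval d-2  = - (+ 2)
dval d-3  = - (+ 3)
dval d-7  = - (+ 7)
dval d-11 = - (+ 11)

-- ω² = ωa + ωb · ω, where ω = √d (d = -1,-2) or ω = (1+√d)/2 (d = -3,-7,-11)
ωa : D → ℤ
ωa d-1  = dval d-1
ωa d-2  = dval d-2
ωa d-3  = - (+ 1)       -- ω² = ω + (d-1)/4
ωa d-7  = - (+ 2)
ωa d-11 = - (+ 3)

ωb : D → ℤ
ωb d-1  = + 0
ωb d-2  = + 0
ωb d-3  = + 1
ωb d-7  = + 1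
ωb d-11 = + 1

record 𝔻 (d : D) : Set where
  constructor _+_ω
  field
    re : ℤ
    im : ℤ
open 𝔻 public

infixl 6 _⊕_
infixl 7 _⊗_

_⊕_ : ∀ {d} → 𝔻 d → 𝔻 d → 𝔻 d
(a + b ω) ⊕ (c + e ω) = (a + c) + (b + e) ω

-- (a + bω)(c + eω) = ac + (ae + bc)ω + be ω²
_⊗_ : ∀ {d} → 𝔻 d → 𝔻 d → 𝔻 d
_⊗_ {d} (a + b ω) (c + e ω) =
  (a * c + b * e * ωa d) + (a * e + b * c + b * e * ωb d) ω

ι : ∀ {d} → ℤ → 𝔻 d
ι r = r + (+ 0) ω

normℤ : ∀ {d} → 𝔻 d → ℤ
normℤ {d} (s + t ω) = s * s + ωb d * s * t - ωa d * t * t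

norm : ∀ {d} → 𝔻 d → ℕ
norm n = ∣ normℤ n ∣

module Submission where

-- Write n = s + tω and N = |n|² = n · n̄, where n̄ = (s + ωb·t) − tω is the
-- conjugate.  Since gcd(t, N) = 1 there are integers u, k with u·t − k·N = 1.
-- Then tω ≡ −s (mod n) and t is invertible modulo N ∈ nℤ[ω], so ω ≡ −s·u
-- (mod n) and every x = a + bω is congruent modulo n to the ordinary integer
-- c = a − b·s·u (`reduceToInteger`).  Reducing c modulo the odd integer N to
-- its centred residue r, c = r + m·N with |r| ≤ (N − 1)/2
-- (`centredResidueOdd`), and absorbing the multiple m·N = n·(m·n̄) into the
-- quotient (`absorbNormMultiple`) gives x = n·q + r.

open import Defs
open import Data.Integer using (ℤ; ∣_∣)
open import Data.Nat using (ℕ; _≤_; _∸_; _/_; _%_)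
open import Data.Nat.GCD using (gcd)
open import Data.Product using (Σ; _×_)
open import Relation.Binary.PropositionalEquality using (_≡_; _≢_)

open import Data.Product using (_,_)
open import Relation.Binary.PropositionalEquality
  using (sym; trans; cong; cong₂; subst; module ≡-Reasoning)
open import Relation.Nullary using (yes; no)
open import Data.Integer using (+_; -[1+_]; 1ℤ; -1ℤ; _+_; _*_; _-_; -_)
import Data.Integer.Properties as ℤP
import Data.Integer.DivMod as ℤD
import Data.Nat as Nat
import Data.Nat.Properties as ℕP
import Data.Nat.DivMod as ℕD
open import Data.Nat.GCD using (gcd-GCD; GCD; module Bézout)
open import Data.Integer.Tactic.RingSolver using (solve-∀)

absAsMultiple : ∀ i → Σ ℤ λ e → + ∣ i ∣ ≡ e * i
absAsMultiple (+ n)    = 1ℤ  , sym (ℤP.*-identityˡ (+ n))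
absAsMultiple -[1+ n ] = -1ℤ , sym (ℤP.-1*i≡-i -[1+ n ])

liftNatEquation : ∀ x m y n → 1 Nat.+ y Nat.* n ≡ x Nat.* m →
  + x * + m - + y * + n ≡ 1ℤ
liftNatEquation x m y n eq = begin
  + x * + m - + y * + n               ≡⟨ cong (_- + y * + n) (sym (ℤP.pos-* x m)) ⟩
  + (x Nat.* m) - + y * + n           ≡⟨ cong (λ z → + z - + y * + n) (sym eq) ⟩
  + (1 Nat.+ y Nat.* n) - + y * + n   ≡⟨ cong (_- + y * + n) (ℤP.pos-+ 1 (y Nat.* n)) ⟩
  1ℤ + + (y Nat.* n) - + y * + n      ≡⟨ cong (λ z → 1ℤ + z - + y * + n) (ℤP.pos-* y n) ⟩
  1ℤ + + y * + n - + y * + n          ≡⟨ cancel 1ℤ (+ y * + n) ⟩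
  1ℤ                                  ∎
  where
  open ≡-Reasoning
  cancel : ∀ i j → i + j - j ≡ i
  cancel = solve-∀

-- Bézout's identity for coprime naturals, with integer coefficients; the
-- library provides it in ℕ with one of two sign patterns.
natBezout : ∀ m n → gcd m n ≡ 1 →
  Σ ℤ λ u → Σ ℤ λ k → u * + m - k * + n ≡ 1ℤ
natBezout m n coprime
  with Bézout.identity (subst (GCD m n) coprime (gcd-GCD m n))
... | Bézout.+- x y eq = + x , + y , liftNatEquation x m y n eq
... | Bézout.-+ x y eq = - + x , - + y ,
  trans (negateBoth (+ x) (+ m) (+ y) (+ n)) (liftNatEquation y n x m eq)
  where
  negateBoth : ∀ x m y n → - x * m - - y * n ≡ y * n - x * m
  negateBoth = solve-∀

integerBezout : ∀ i j → gcd ∣ i ∣ ∣ j ∣ ≡ 1 →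
  Σ ℤ λ u → Σ ℤ λ k → u * i - k * j ≡ 1ℤ
integerBezout i j coprime =
  let (u , k , eq) = natBezout ∣ i ∣ ∣ j ∣ coprime
      (eᵢ , ∣i∣≡) = absAsMultiple i
      (eⱼ , ∣j∣≡) = absAsMultiple j
  in u * eᵢ , k * eⱼ , (begin
    u * eᵢ * i - k * eⱼ * j       ≡⟨ reassociate u eᵢ i k eⱼ j ⟩
    u * (eᵢ * i) - k * (eⱼ * j)   ≡⟨ cong₂ (λ a b → u * a - k * b) (sym ∣i∣≡) (sym ∣j∣≡) ⟩
    u * + ∣ i ∣ - k * + ∣ j ∣     ≡⟨ eq ⟩
    1ℤ                            ∎)
  where
  open ≡-Reasoning
  reassociate : ∀ u e i k f j → u * e * i - k * f * j ≡ u * (e * i) - k * (f * j)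
  reassociate = solve-∀

-- The centred residue modulo an odd number 2h + 1: every integer is
-- r + m·(2h + 1) with |r| ≤ h (take r = ρ − h, ρ the residue of a + h).
centredResidue : ∀ h a → Σ ℤ λ r → Σ ℤ λ m →
  ∣ r ∣ ≤ h × a ≡ r + m * + Nat.suc (h Nat.* 2)
centredResidue h a = + ρ - + h , (a + + h) ℤD./ M , centred , decomposition
  where
  M : ℤ
  M = + Nat.suc (h Nat.* 2)
  ρ : ℕ
  ρ = (a + + h) ℤD.% M

  ρ≤h+h : ρ ≤ h Nat.+ h
  ρ≤h+h = ℕP.≤-trans (ℕP.≤-pred (ℤD.n%d<d (a + + h) M)) (ℕP.≤-reflexive (double h))
    where
    double : ∀ h → h Nat.* 2 ≡ h Nat.+ h
    double h = trans (ℕP.*-comm h 2) (cong (h Nat.+_) (ℕP.+-identityʳ h))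

  centred : ∣ + ρ - + h ∣ ≤ h
  centred rewrite ℤP.m-n≡m⊖n ρ h with ρ Nat.≤? h
  ... | yes ρ≤h rewrite ℤP.∣⊖∣-≤ ρ≤h = ℕP.m∸n≤m h ρ
  ... | no ρ≰h rewrite ℤP.∣m⊖n∣≡∣n⊖m∣ ρ h | ℤP.∣⊖∣-≤ (ℕP.≰⇒≥ ρ≰h) =
    ℕP.m≤n+o⇒m∸n≤o ρ h ρ≤h+h

  decomposition : a ≡ (+ ρ - + h) + (a + + h) ℤD./ M * M
  decomposition = begin
    a                                  ≡⟨ shift a (+ h) ⟩
    (a + + h) - + h                    ≡⟨ cong (_- + h) (ℤD.a≡a%n+[a/n]*n (a + + h) M) ⟩
    (+ ρ + (a + + h) ℤD./ M * M) - + h ≡⟨ regroup (+ ρ) (+ h) ((a + + h) ℤD./ M * M) ⟩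
    (+ ρ - + h) + (a + + h) ℤD./ M * M ∎
    where
    open ≡-Reasoning
    shift : ∀ a h → a ≡ (a + h) - h
    shift = solve-∀
    regroup : ∀ ρ h q → (ρ + q) - h ≡ (ρ - h) + q
    regroup = solve-∀

oddDecomposition : ∀ N → N % 2 ≡ 1 → Nat.suc ((N ∸ 1) / 2 Nat.* 2) ≡ N
oddDecomposition N odd = begin
  Nat.suc ((N ∸ 1) / 2 Nat.* 2)        ≡⟨ cong (λ z → Nat.suc ((z ∸ 1) / 2 Nat.* 2)) N≡ ⟩
  Nat.suc (N / 2 Nat.* 2 / 2 Nat.* 2)  ≡⟨ cong (λ z → Nat.suc (z Nat.* 2)) (ℕD.m*n/n≡m (N / 2) 2) ⟩
  Nat.suc (N / 2 Nat.* 2)              ≡⟨ sym N≡ ⟩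
  N                                    ∎
  where
  open ≡-Reasoning
  N≡ : N ≡ Nat.suc (N / 2 Nat.* 2)
  N≡ = trans (ℕD.m≡m%n+[m/n]*n N 2) (cong (Nat._+ N / 2 Nat.* 2) odd)

centredResidueOdd : ∀ z a → ∣ z ∣ % 2 ≡ 1 → Σ ℤ λ r → Σ ℤ λ m →
  ∣ r ∣ ≤ (∣ z ∣ ∸ 1) / 2 × a ≡ r + m * z
centredResidueOdd z a odd =
  let (r , m , bound , a≡) = centredResidue ((∣ z ∣ ∸ 1) / 2) a
      (e , ∣z∣≡) = absAsMultiple z
  in r , m * e , bound , (begin
    a                                            ≡⟨ a≡ ⟩
    r + m * + Nat.suc ((∣ z ∣ ∸ 1) / 2 Nat.* 2)  ≡⟨ cong (λ N → r + m * + N) (oddDecomposition ∣ z ∣ odd) ⟩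
    r + m * + ∣ z ∣                              ≡⟨ cong (λ w → r + m * w) ∣z∣≡ ⟩
    r + m * (e * z)                              ≡⟨ cong (λ w → r + w) (sym (ℤP.*-assoc m e z)) ⟩
    r + m * e * z                                ∎)
  where open ≡-Reasoning

-- The conjugate n̄ of n = s + tω: ω replaced by the other root ωb − ω of
-- X² − ωb·X − ωa, i.e. n̄ = (s + ωb·t) − tω; then n · n̄ = |n|².
conj : ∀ {d} → 𝔻 d → 𝔻 d
conj {d} (s + t ω) = (s + ωb d * t) + (- t) ω

infixl 7 _·_
_·_ : ∀ {d} → ℤ → 𝔻 d → 𝔻 d
m · (a + b ω) = (m * a) + (m * b) ω

-- Every element is congruent to an integer modulo n = s + tω once t is
-- invertible modulo |n|²: from u·t − k·|n|² = 1 one gets ω ≡ −s·u (mod n),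
-- with quotient u − k·n̄·ω, hence a + bω ≡ a − b·s·u (mod n).
reduceToInteger : ∀ {d} (n : 𝔻 d) (u k : ℤ) → u * im n - k * normℤ n ≡ 1ℤ →
  (x : 𝔻 d) → Σ (𝔻 d) λ q → x ≡ n ⊗ q ⊕ ι (re x - im x * re n * u)
reduceToInteger {d} (s + t ω) u k bezout (a + b ω) =
  b · ((u + k * t * A) + (- (k * s)) ω) , cong₂ _+_ω (reIdentity a b s t u k A) imEq
  where
  -- The real parts agree identically; the nonreal parts agree by u·t − k·|n|² = 1.
  A B : ℤ
  A = ωa d
  B = ωb d
  reIdentity : ∀ a b s t u k A →
    a ≡ s * (b * (u + k * t * A)) + t * (b * - (k * s)) * A + (a - b * s * u)
  reIdentity = solve-∀
  imIdentity : ∀ b s t u k A B →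
    s * (b * - (k * s)) + t * (b * (u + k * t * A)) + t * (b * - (k * s)) * B + + 0
    ≡ b * (u * t - k * (s * s + B * s * t - A * t * t))
  imIdentity = solve-∀
  imEq : b ≡ s * (b * - (k * s)) + t * (b * (u + k * t * A)) + t * (b * - (k * s)) * B + + 0
  imEq = begin
    b                                                  ≡⟨ sym (ℤP.*-identityʳ b) ⟩
    b * 1ℤ                                             ≡⟨ cong (b *_) (sym bezout) ⟩
    b * (u * t - k * (s * s + B * s * t - A * t * t))  ≡⟨ sym (imIdentity b s t u k A B) ⟩
    s * (b * - (k * s)) + t * (b * (u + k * t * A)) + t * (b * - (k * s)) * B + + 0  ∎
    where open ≡-Reasoning

absorbNormMultiple : ∀ {d} (n q : 𝔻 d) (r m : ℤ) →
  n ⊗ q ⊕ ι (r + m * normℤ n) ≡ n ⊗ (q ⊕ m · conj n) ⊕ ι r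
absorbNormMultiple {d} (s + t ω) (q₁ + q₂ ω) r m =
  cong₂ _+_ω (reIdentity s t q₁ q₂ r m (ωa d) (ωb d)) (imIdentity s t q₁ q₂ r m (ωa d) (ωb d))
  where
  reIdentity : ∀ s t q₁ q₂ r m A B →
    s * q₁ + t * q₂ * A + (r + m * (s * s + B * s * t - A * t * t))
    ≡ s * (q₁ + m * (s + B * t))
      + t * (q₂ + m * (- t)) * A + r
  reIdentity = solve-∀
  imIdentity : ∀ s t q₁ q₂ r m A B →
    s * q₂ + t * q₁ + t * q₂ * B + + 0
    ≡ s * (q₂ + m * (- t))
      + t * (q₁ + m * (s + B * t))
      + t * (q₂ + m * (- t)) * B + + 0
  imIdentity = solve-∀

proposition7 : (d : D) (x n : 𝔻 d) →
    norm n % 2 ≡ 1 →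
    norm n ≢ 1 →
    gcd ∣ im n ∣ (norm n) ≡ 1 →
    Σ (𝔻 d) λ q → Σ ℤ λ r →
    (∣ r ∣ ≤ (norm n ∸ 1) / 2) × (x ≡ n ⊗ q ⊕ ι r)
proposition7 d x n odd _ coprime =
  let (u , k , bezout)     = integerBezout (im n) (normℤ n) coprime
      (q₀ , x≡q₀)          = reduceToInteger n u k bezout x
      c                    = re x - im x * re n * u
      (r , m , bound , c≡) = centredResidueOdd (normℤ n) c odd
  in q₀ ⊕ m · conj n , r , bound , (begin
    x                                ≡⟨ x≡q₀ ⟩
    n ⊗ q₀ ⊕ ι c                     ≡⟨ cong (λ c′ → n ⊗ q₀ ⊕ ι c′) c≡ ⟩
    n ⊗ q₀ ⊕ ι (r + m * normℤ n)     ≡⟨ absorbNormMultiple n q₀ r m ⟩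
    n ⊗ (q₀ ⊕ m · conj n) ⊕ ι r      ∎)
  where open ≡-Reasoning
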